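{- Let $p,q,M$ be nonnegative integers and put $t_1=pM$ and $t_2=pqM^2+M$. Then for all integers $b,c$: $b\equiv c \pmod M$ if and only if there exist integers $w_1,w_2$ with $b-c-t_1w_1-t_2w_2=0$. In particular, congruence modulo $M$ is definable using only multiplication by $t_1$ and by $t_2$.
   Context: Congruence modulo $0$ is understood as equality. -}

module Defs where

open import Data.Nat using (ℕ)
open import Data.Integer using (ℤ; +_; _-_)
open import Data.Integer.Divisibility using (_∣_)

-- Congruence modulo M (M : ℕ) on integers: M divides b - c.
-- For M = 0 this is equality, since 0 ∣ x holds iff x = 0 (stdlib divisibility).
_≡_[mod_] : ℤ → ℤ → ℕ → Set
b ≡ c [mod M ] = (+ M) ∣ (b - c)

t₁ : ℕ → ℕ → ℕ → ℤ
t₁ p q M = + (p Data.Nat.* M)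

t₂ : ℕ → ℕ → ℕ → ℤ
t₂ p q M = + (p Data.Nat.* q Data.Nat.* (M Data.Nat.* M) Data.Nat.+ M)

-- Both t₁ = pM and t₂ = pqM² + M are multiples of M, and M = t₂ - qM·t₁.
-- Hence the ideal of ℤ generated by t₁ and t₂ is exactly Mℤ, and b - c lies in
-- it precisely when M ∣ b - c.
module Submission where

open import Defs
open import Data.Nat using (ℕ)
import Data.Nat as ℕ
open import Data.Integer using (ℤ; +_; -_; _+_; _-_; _*_; 0ℤ; 1ℤ)
open import Data.Integer.Properties using (pos-+; pos-*; i-j≡0⇒i≡j; *-zeroʳ)
open import Data.Integer.Divisibility.Signed
  using (_∣_; divides; ∣ᵤ⇒∣; ∣⇒∣ᵤ; ∣-refl; ∣n⇒∣m*n; ∣m⇒∣m*n; ∣m∣n⇒∣m+n)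
open import Data.Integer.Tactic.RingSolver using (solve-∀)
open import Data.Product using (∃₂; _,_)
open import Function.Base using (_∘_)
open import Function.Bundles using (_⇔_; mk⇔; module Equivalence)
open import Relation.Binary.PropositionalEquality using (_≡_; refl; sym; trans; cong; cong₂; subst; subst₂)
open import Relation.Binary.PropositionalEquality.Properties using (module ≡-Reasoning)

_∈⟨_,_⟩ : ℤ → ℤ → ℤ → Set
x ∈⟨ a , b ⟩ = ∃₂ λ (w₁ w₂ : ℤ) → x - a * w₁ - b * w₂ ≡ 0ℤ

∈⟨⟩⇒≡-combination : ∀ x a b w₁ w₂ →
  x - a * w₁ - b * w₂ ≡ 0ℤ → x ≡ a * w₁ + b * w₂
∈⟨⟩⇒≡-combination x a b w₁ w₂ e =
  i-j≡0⇒i≡j x (a * w₁ + b * w₂) (trans (regroup x a b w₁ w₂) e)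
  where
  regroup : ∀ x a b w₁ w₂ → x - (a * w₁ + b * w₂) ≡ x - a * w₁ - b * w₂
  regroup = solve-∀

∣-∈⟨⟩ : ∀ {m a b x} → m ∣ a → m ∣ b → x ∈⟨ a , b ⟩ → m ∣ x
∣-∈⟨⟩ {m} {a} {b} {x} m∣a m∣b (w₁ , w₂ , e) =
  subst (m ∣_) (sym (∈⟨⟩⇒≡-combination x a b w₁ w₂ e))
    (∣m∣n⇒∣m+n (∣m⇒∣m*n w₁ m∣a) (∣m⇒∣m*n w₂ m∣b))

∈⟨⟩-multiple : ∀ {m a b x} → m ∈⟨ a , b ⟩ → m ∣ x → x ∈⟨ a , b ⟩
∈⟨⟩-multiple {m} {a} {b} (u , v , e) (divides k refl) = u * k , v * k , (begin
  k * m - a * (u * k) - b * (v * k) ≡⟨ scale k m a b u v ⟩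
  k * (m - a * u - b * v)           ≡⟨ cong (k *_) e ⟩
  k * 0ℤ                            ≡⟨ *-zeroʳ k ⟩
  0ℤ                                ∎)
  where
  open ≡-Reasoning
  scale : ∀ k m a b u v → k * m - a * (u * k) - b * (v * k) ≡ k * (m - a * u - b * v)
  scale = solve-∀

∣⇔∈⟨⟩ : ∀ {m a b} → m ∣ a → m ∣ b → m ∈⟨ a , b ⟩ → ∀ x → m ∣ x ⇔ x ∈⟨ a , b ⟩
∣⇔∈⟨⟩ {m} {a} {b} m∣a m∣b m∈⟨a,b⟩ x =
  mk⇔ (∈⟨⟩-multiple {m} {a} {b} m∈⟨a,b⟩) (∣-∈⟨⟩ {m} {a} {b} m∣a m∣b)

t₁≡ : ∀ p q M → t₁ p q M ≡ + p * + M
t₁≡ p q M = pos-* p M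

t₂≡ : ∀ p q M → t₂ p q M ≡ + p * + q * (+ M * + M) + + M
t₂≡ p q M = trans (pos-+ (p ℕ.* q ℕ.* (M ℕ.* M)) M)
  (cong (_+ + M) (trans (pos-* (p ℕ.* q) (M ℕ.* M)) (cong₂ _*_ (pos-* p q) (pos-* M M))))

module _ (p q M : ℕ) where

  private
    P Q m : ℤ
    P = + p
    Q = + q
    m = + M

  M∣t₁ : m ∣ t₁ p q M
  M∣t₁ = subst (m ∣_) (sym (t₁≡ p q M)) (∣n⇒∣m*n P ∣-refl)

  M∣t₂ : m ∣ t₂ p q M
  M∣t₂ = subst (m ∣_) (sym (t₂≡ p q M))
    (∣m∣n⇒∣m+n (∣n⇒∣m*n (P * Q) (∣n⇒∣m*n m ∣-refl)) ∣-refl)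

  M∈⟨t₁,t₂⟩ : m ∈⟨ t₁ p q M , t₂ p q M ⟩
  M∈⟨t₁,t₂⟩ = subst₂ (λ a b → m ∈⟨ a , b ⟩) (sym (t₁≡ p q M)) (sym (t₂≡ p q M))
    (- (Q * m) , 1ℤ , combination P Q m)
    where
    combination : ∀ P Q m → m - P * m * - (Q * m) - (P * Q * (m * m) + m) * 1ℤ ≡ 0ℤ
    combination = solve-∀

lemma2p4 : (p q M : ℕ) (b c : ℤ) →
    (b ≡ c [mod M ]) ⇔ (∃₂ λ (w₁ w₂ : ℤ) → b - c - t₁ p q M * w₁ - t₂ p q M * w₂ ≡ 0ℤ)
lemma2p4 p q M b c = mk⇔ (to ∘ ∣ᵤ⇒∣) (∣⇒∣ᵤ ∘ from)
  where open Equivalence (∣⇔∈⟨⟩ (M∣t₁ p q M) (M∣t₂ p q M) (M∈⟨t₁,t₂⟩ p q M) (b - c))
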